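{- Let $G=(V,E)$ be a finite, connected, undirected graph with at least two nodes and with positive edge weights; let $\overline{\omega}$ and $\underline{\omega}$ be the maximum and minimum edge weights, and $d(x,y)$ the weighted shortest-path distance. Let $s\in V$ be any node and let $u,v\in V$, $u\neq v$, satisfy $d(s,u)\ge d(s,v)\ge d(s,x)$ for all $x\in V\setminus\{u\}$. Define $\tilde{\mathit{VD}}_{\mathrm{W}}:=1+\frac{d(s,u)+d(s,v)}{\underline{\omega}}$. Then $$\mathit{VD}(G)\le\tilde{\mathit{VD}}_{\mathrm{W}}<2\,\mathit{VD}(G)\,\frac{\overline{\omega}}{\underline{\omega}}.$$
   Context: The vertex diameter $\mathit{VD}(G)$ of a (weighted) graph $G$ is the maximum, over all shortest paths in $G$ (shortest with respect to total edge weight, between any pair of nodes), of the number of nodes on that path.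
   Formalization: The edge weights are positive rationals, so the distances $d(x,y)$ and the weights $\overline{\omega}$ and $\underline{\omega}$ are rational as well. -}

module Defs where

open import Data.Nat using (ℕ; zero; suc)
open import Data.Fin using (Fin)
open import Data.Bool using (Bool; true)
open import Data.Integer using (+_)
open import Data.Rational using (ℚ; 0ℚ; _+_; _/_; _÷_; _≤_; _<_; >-nonZero)
open import Data.Product using (Σ; ∃; _×_)
open import Relation.Binary.PropositionalEquality using (_≡_)
open import Relation.Nullary using (¬_)

record WGraph (n : ℕ) : Set where
  field
    adj      : Fin n → Fin n → Bool
    adj-sym  : ∀ x y → adj x y ≡ true → adj y x ≡ true
    adj-irr  : ∀ x → ¬ (adj x x ≡ true)
    w        : Fin n → Fin n → ℚ
    w-sym    : ∀ x y → adj x y ≡ true → w x y ≡ w y x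
    w-pos    : ∀ x y → adj x y ≡ true → 0ℚ < w x y

module _ {n : ℕ} (G : WGraph n) where
  open WGraph G

  data Walk : Fin n → Fin n → Set where
    node : ∀ x → Walk x x
    step : ∀ x {y z} → adj x y ≡ true → Walk y z → Walk x z

  weight : ∀ {x y} → Walk x y → ℚ
  weight (node x) = 0ℚ
  weight (step x {y} _ p) = w x y + weight p

  nodes : ∀ {x y} → Walk x y → ℕ
  nodes (node x) = 1
  nodes (step x _ p) = suc (nodes p)

  Connected : Set
  Connected = ∀ x y → Walk x y

  IsDistance : (Fin n → Fin n → ℚ) → Set
  IsDistance d = ∀ x y →
    Σ (Walk x y) (λ p → weight p ≡ d x y) × (∀ (q : Walk x y) → d x y ≤ weight q)

  IsShortest : (Fin n → Fin n → ℚ) → ∀ {x y} → Walk x y → Set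
  IsShortest d {x} {y} p = weight p ≡ d x y

  IsVD : (Fin n → Fin n → ℚ) → ℕ → Set
  IsVD d k =
    (∃ λ x → ∃ λ y → Σ (Walk x y) (λ p → IsShortest d p × nodes p ≡ k))
    × (∀ x y (p : Walk x y) → IsShortest d p → nodes p ≤ℕ k)
    where open import Data.Nat using () renaming (_≤_ to _≤ℕ_)

  IsMaxWeight : ℚ → Set
  IsMaxWeight m = (∃ λ x → ∃ λ y → adj x y ≡ true × w x y ≡ m)
                × (∀ x y → adj x y ≡ true → w x y ≤ m)

  IsMinWeight : ℚ → Set
  IsMinWeight m = (∃ λ x → ∃ λ y → adj x y ≡ true × w x y ≡ m)
                × (∀ x y → adj x y ≡ true → m ≤ w x y)

toℚ : ℕ → ℚ
toℚ k = (+ k) / 1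

divPos : (p q : ℚ) → 0ℚ < q → ℚ
divPos p q h = _÷_ p q {{>-nonZero h}}

module Submission where

open import Defs
open import Data.Nat using (ℕ; _≥_)
open import Data.Fin using (Fin)
open import Data.Rational using (ℚ; 0ℚ; 1ℚ; _+_; _*_; _≤_; _<_)
open import Data.Product using (_×_)
open import Relation.Binary.PropositionalEquality using (_≢_)

import Data.Nat as ℕ
import Data.Integer as ℤ
import Data.Integer.Properties as ℤ
open import Data.Nat.Coprimality using (1-coprimeTo) renaming (sym to coprime-sym)
open import Data.Rational
  using (mkℚ; _/_; _÷_; 1/_; *≤*; positive; nonNegative; Positive; NonNegative; NonZero; >-nonZero)
open import Data.Rational.Properties
open import Data.Rational.Solver using (module +-*-Solver)
open import Data.Bool using (true)
open import Data.Fin.Properties using () renaming (_≟_ to _≟ᶠ_)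
open import Data.Product using (_,_; proj₁; proj₂)
open import Relation.Binary.PropositionalEquality
open import Relation.Nullary using (yes; no)

-- A shortest path with k nodes has k - 1 edges, so its weight, a distance,
-- lies between (k - 1)·ω̲ and (k - 1)·ω̄. Every distance is at most
-- d(s,u) + d(s,v) by the triangle inequality through s, since at most one
-- endpoint is u; this gives VD ≤ 1 + (d(s,u) + d(s,v))/ω̲. Conversely the
-- shortest paths from s to u and to v have at most VD nodes, so
-- d(s,u) + d(s,v) ≤ 2(VD - 1)·ω̄, and ω̲ < 2ω̄ gives the strict bound.

toℚ≡mkℚ : ∀ k → toℚ k ≡ mkℚ (ℤ.+ k) 0 (coprime-sym (1-coprimeTo k))
toℚ≡mkℚ k = normalize-coprime (coprime-sym (1-coprimeTo k))

toℚ-suc : ∀ k → toℚ (ℕ.suc k) ≡ 1ℚ + toℚ k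
toℚ-suc k = begin
  toℚ (ℕ.suc k)                                     ≡⟨ cong (λ i → (ℤ.+ 1 ℤ.+ i) / 1) (ℤ.*-identityʳ (ℤ.+ k)) ⟨
  (ℤ.+ 1 ℤ.+ ℤ.+ k ℤ.* ℤ.+ 1) / 1                   ≡⟨⟩
  1ℚ + mkℚ (ℤ.+ k) 0 (coprime-sym (1-coprimeTo k))  ≡⟨ cong (1ℚ +_) (toℚ≡mkℚ k) ⟨
  1ℚ + toℚ k                                        ∎
  where open ≡-Reasoning

toℚ-mono-≤ : ∀ {a b} → a ℕ.≤ b → toℚ a ≤ toℚ b
toℚ-mono-≤ {a} {b} a≤b = subst₂ _≤_ (sym (toℚ≡mkℚ a)) (sym (toℚ≡mkℚ b))
  (*≤* (ℤ.*-monoʳ-≤-nonNeg (ℤ.+ 1) (ℤ.+≤+ a≤b)))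

÷-*-cancel : ∀ p q .{{_ : NonZero q}} → (p ÷ q) * q ≡ p
÷-*-cancel p q = begin
  (p * 1/ q) * q  ≡⟨ *-assoc p (1/ q) q ⟩
  p * (1/ q * q)  ≡⟨ cong (p *_) (*-inverseˡ q) ⟩
  p * 1ℚ          ≡⟨ *-identityʳ p ⟩
  p               ∎
  where open ≡-Reasoning

[1+p÷q]*q≡q+p : ∀ p q .{{_ : NonZero q}} → (1ℚ + p ÷ q) * q ≡ q + p
[1+p÷q]*q≡q+p p q = trans (*-distribʳ-+ q 1ℚ (p ÷ q)) (cong₂ _+_ (*-identityˡ q) (÷-*-cancel p q))

module _ {n : ℕ} (G : WGraph n) where
  open WGraph G

  infixr 5 _++_

  _++_ : ∀ {x y z} → Walk G x y → Walk G y z → Walk G x z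
  node x     ++ q = q
  step x a p ++ q = step x a (p ++ q)

  reverse : ∀ {x y} → Walk G x y → Walk G y x
  reverse (node x)         = node x
  reverse (step x {y} a p) = reverse p ++ step y (adj-sym x y a) (node x)

  weight-++ : ∀ {x y z} (p : Walk G x y) (q : Walk G y z) →
              weight G (p ++ q) ≡ weight G p + weight G q
  weight-++ (node x)         q = sym (+-identityˡ (weight G q))
  weight-++ (step x {y} a p) q = trans (cong (w x y +_) (weight-++ p q))
                                       (sym (+-assoc (w x y) (weight G p) (weight G q)))

  weight-reverse : ∀ {x y} (p : Walk G x y) → weight G (reverse p) ≡ weight G p
  weight-reverse (node x)         = refl
  weight-reverse (step x {y} a p) = begin
    weight G (reverse p ++ step y (adj-sym x y a) (node x))
      ≡⟨ weight-++ (reverse p) (step y (adj-sym x y a) (node x)) ⟩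
    weight G (reverse p) + (w y x + 0ℚ)
      ≡⟨ cong₂ _+_ (weight-reverse p) (trans (+-identityʳ (w y x)) (sym (w-sym x y a))) ⟩
    weight G p + w x y
      ≡⟨ +-comm (weight G p) (w x y) ⟩
    w x y + weight G p ∎
    where open ≡-Reasoning

  weight-nonNeg : ∀ {x y} (p : Walk G x y) → 0ℚ ≤ weight G p
  weight-nonNeg (node x)         = ≤-refl
  weight-nonNeg (step x {y} a p) =
    subst (_≤ w x y + weight G p) (+-identityˡ 0ℚ)
          (+-mono-≤ (<⇒≤ (w-pos x y a)) (weight-nonNeg p))

  nodes*m≤weight+m : ∀ m → (∀ x y → adj x y ≡ true → m ≤ w x y) →
                     ∀ {x y} (p : Walk G x y) → toℚ (nodes G p) * m ≤ weight G p + m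
  nodes*m≤weight+m m m≤w (node x) = ≤-reflexive (trans (*-identityˡ m) (sym (+-identityˡ m)))
  nodes*m≤weight+m m m≤w (step x {y} a p) = begin
    toℚ (ℕ.suc (nodes G p)) * m    ≡⟨ cong (_* m) (toℚ-suc (nodes G p)) ⟩
    (1ℚ + toℚ (nodes G p)) * m     ≡⟨ *-distribʳ-+ m 1ℚ (toℚ (nodes G p)) ⟩
    1ℚ * m + toℚ (nodes G p) * m   ≡⟨ cong (_+ toℚ (nodes G p) * m) (*-identityˡ m) ⟩
    m + toℚ (nodes G p) * m        ≤⟨ +-mono-≤ (m≤w x y a) (nodes*m≤weight+m m m≤w p) ⟩
    w x y + (weight G p + m)       ≡⟨ +-assoc (w x y) (weight G p) m ⟨
    w x y + weight G p + m         ∎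
    where open ≤-Reasoning

  weight+M≤nodes*M : ∀ M → (∀ x y → adj x y ≡ true → w x y ≤ M) →
                     ∀ {x y} (p : Walk G x y) → weight G p + M ≤ toℚ (nodes G p) * M
  weight+M≤nodes*M M w≤M (node x) = ≤-reflexive (trans (+-identityˡ M) (sym (*-identityˡ M)))
  weight+M≤nodes*M M w≤M (step x {y} a p) = begin
    w x y + weight G p + M         ≡⟨ +-assoc (w x y) (weight G p) M ⟩
    w x y + (weight G p + M)       ≤⟨ +-mono-≤ (w≤M x y a) (weight+M≤nodes*M M w≤M p) ⟩
    M + toℚ (nodes G p) * M        ≡⟨ cong (_+ toℚ (nodes G p) * M) (*-identityˡ M) ⟨
    1ℚ * M + toℚ (nodes G p) * M   ≡⟨ *-distribʳ-+ M 1ℚ (toℚ (nodes G p)) ⟨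
    (1ℚ + toℚ (nodes G p)) * M     ≡⟨ cong (_* M) (toℚ-suc (nodes G p)) ⟨
    toℚ (ℕ.suc (nodes G p)) * M    ∎
    where open ≤-Reasoning

  minWeight≤maxWeight : ∀ {m M} → IsMinWeight G m → IsMaxWeight G M → m ≤ M
  minWeight≤maxWeight ((x , y , a , w≡m) , _) (_ , w≤M) = subst (_≤ _) w≡m (w≤M x y a)

  module _ {d : Fin n → Fin n → ℚ} (isD : IsDistance G d) where

    d-nonNeg : ∀ x y → 0ℚ ≤ d x y
    d-nonNeg x y with proj₁ (isD x y)
    ... | p , p≡d = subst (0ℚ ≤_) p≡d (weight-nonNeg p)

    d[x,x]≤0 : ∀ x → d x x ≤ 0ℚ
    d[x,x]≤0 x = proj₂ (isD x x) (node x)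

    d[x,y]≤d[s,x]+d[s,y] : ∀ s x y → d x y ≤ d s x + d s y
    d[x,y]≤d[s,x]+d[s,y] s x y with proj₁ (isD s x) | proj₁ (isD s y)
    ... | p , p≡d | q , q≡d = begin
      d x y                                ≤⟨ proj₂ (isD x y) (reverse p ++ q) ⟩
      weight G (reverse p ++ q)            ≡⟨ weight-++ (reverse p) q ⟩
      weight G (reverse p) + weight G q    ≡⟨ cong₂ _+_ (trans (weight-reverse p) p≡d) q≡d ⟩
      d s x + d s y                        ∎
      where open ≤-Reasoning

    module _ {s u v : Fin n} (dsv≤dsu : d s v ≤ d s u)
             (dsx≤dsv : ∀ x → x ≢ u → d s x ≤ d s v) where

      d[s,x]≤d[s,u] : ∀ x → d s x ≤ d s u
      d[s,x]≤d[s,u] x with x ≟ᶠ u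
      ... | yes refl = ≤-refl
      ... | no x≢u   = ≤-trans (dsx≤dsv x x≢u) dsv≤dsu

      d≤d[s,u]+d[s,v] : ∀ x y → d x y ≤ d s u + d s v
      d≤d[s,u]+d[s,v] x y with x ≟ᶠ u | y ≟ᶠ u
      ... | no x≢u | _ = ≤-trans (d[x,y]≤d[s,x]+d[s,y] s x y)
        (subst (d s x + d s y ≤_) (+-comm (d s v) (d s u))
               (+-mono-≤ (dsx≤dsv x x≢u) (d[s,x]≤d[s,u] y)))
      ... | yes refl | no y≢u = ≤-trans (d[x,y]≤d[s,x]+d[s,y] s u y)
        (+-monoʳ-≤ (d s u) (dsx≤dsv y y≢u))
      ... | yes refl | yes refl = ≤-trans (d[x,x]≤0 u)
        (subst (_≤ d s u + d s v) (+-identityˡ 0ℚ) (+-mono-≤ (d-nonNeg s u) (d-nonNeg s v)))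

    module _ {VD : ℕ} (isVD : IsVD G d VD) where

      VD*m≤D+m : ∀ {m D} → (∀ x y → adj x y ≡ true → m ≤ w x y) →
                 (∀ x y → d x y ≤ D) → toℚ VD * m ≤ D + m
      VD*m≤D+m {m} {D} m≤w d≤D with proj₁ isVD
      ... | x , y , p , p≡d , nodes≡VD = begin
        toℚ VD * m              ≡⟨ cong (λ k → toℚ k * m) nodes≡VD ⟨
        toℚ (nodes G p) * m     ≤⟨ nodes*m≤weight+m m m≤w p ⟩
        weight G p + m          ≡⟨ cong (_+ m) p≡d ⟩
        d x y + m               ≤⟨ +-monoˡ-≤ m (d≤D x y) ⟩
        D + m                   ∎
        where open ≤-Reasoning

      d+M≤VD*M : ∀ {M} .{{_ : NonNegative M}} → (∀ x y → adj x y ≡ true → w x y ≤ M) →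
                 ∀ x y → d x y + M ≤ toℚ VD * M
      d+M≤VD*M {M} w≤M x y with proj₁ (isD x y)
      ... | p , p≡d = begin
        d x y + M             ≡⟨ cong (_+ M) p≡d ⟨
        weight G p + M        ≤⟨ weight+M≤nodes*M M w≤M p ⟩
        toℚ (nodes G p) * M   ≤⟨ *-monoʳ-≤-nonNeg M (toℚ-mono-≤ (proj₂ isVD x y p p≡d)) ⟩
        toℚ VD * M            ∎
        where open ≤-Reasoning

proposition2 : (n : ℕ) → n ≥ 2 → (G : WGraph n) → Connected G
    → (d : Fin n → Fin n → ℚ) → IsDistance G d
    → (wmax wmin : ℚ) → IsMaxWeight G wmax → IsMinWeight G wmin
    → (wmin>0 : 0ℚ < wmin)
    → (VD : ℕ) → IsVD G d VD
    → (s u v : Fin n) → u ≢ v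
    → d s v ≤ d s u → (∀ x → x ≢ u → d s x ≤ d s v)
    → (toℚ VD ≤ 1ℚ + divPos (d s u + d s v) wmin wmin>0)
    × (1ℚ + divPos (d s u + d s v) wmin wmin>0
    < divPos ((toℚ 2 * toℚ VD) * wmax) wmin wmin>0)
proposition2 n _ G _ d isD M m isMax isMin m>0 VD isVD s u v _ dsv≤dsu dsx≤dsv =
  *-cancelʳ-≤-pos m (begin
    V * m                      ≤⟨ VD*m≤D+m G isD isVD (proj₂ isMin) d≤c ⟩
    c + m                      ≡⟨ +-comm c m ⟩
    m + c                      ≡⟨ [1+p÷q]*q≡q+p c m ⟨
    (1ℚ + c ÷ m) * m           ∎) ,
  *-cancelʳ-<-nonNeg m (begin-strict
    (1ℚ + c ÷ m) * m           ≡⟨ [1+p÷q]*q≡q+p c m ⟩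
    m + c                      <⟨ +-monoˡ-< c m<M+M ⟩
    (M + M) + c                ≡⟨ solve 3 (λ a b M → (M :+ M) :+ (a :+ b) := (a :+ M) :+ (b :+ M))
                                        refl (d s u) (d s v) M ⟩
    (d s u + M) + (d s v + M)  ≤⟨ +-mono-≤ (d[s,x]+M≤VD*M u) (d[s,x]+M≤VD*M v) ⟩
    V * M + V * M              ≡⟨ solve 2 (λ V M → V :* M :+ V :* M := ((con 1ℚ :+ con 1ℚ) :* V) :* M)
                                        refl V M ⟩
    (toℚ 2 * V) * M            ≡⟨ ÷-*-cancel ((toℚ 2 * V) * M) m ⟨
    ((toℚ 2 * V) * M ÷ m) * m  ∎)
  where
  open ≤-Reasoning
  open +-*-Solver
  V : ℚ
  V = toℚ VD
  c : ℚ
  c = d s u + d s v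
  m≤M : m ≤ M
  m≤M = minWeight≤maxWeight G isMin isMax
  0<M : 0ℚ < M
  0<M = <-≤-trans m>0 m≤M
  instance
    m-nonZero : NonZero m
    m-nonZero = >-nonZero m>0
    m-positive : Positive m
    m-positive = positive m>0
    m-nonNeg : NonNegative m
    m-nonNeg = nonNegative (<⇒≤ m>0)
    M-nonNeg : NonNegative M
    M-nonNeg = nonNegative (<⇒≤ 0<M)
  d≤c : ∀ x y → d x y ≤ c
  d≤c = d≤d[s,u]+d[s,v] G isD dsv≤dsu dsx≤dsv
  d[s,x]+M≤VD*M : ∀ x → d s x + M ≤ V * M
  d[s,x]+M≤VD*M = d+M≤VD*M G isD isVD (proj₂ isMax) s
  m<M+M : m < M + M
  m<M+M = ≤-<-trans m≤M (subst (_< M + M) (+-identityˡ M) (+-monoˡ-< M 0<M))
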